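{- Let $\to$ be the quantifier-elimination rewrite relation on formulas defined in the context. Then $\to$ is confluent: whenever $F\to^* F_1$ and $F\to^* F_2$, there is a formula $G$ with $F_1\to^* G$ and $F_2\to^* G$. Here $\to^*$ denotes the reflexive transitive closure of $\to$.
   Context: Terms and formulas are those of first-order logic extended by Hilbert's $\varepsilon$-binder. The syntax has: - individual variables; - $n$-ary formula variables (free second-order variables, never bound); - $n$-ary function and predicate symbols; - the connectives $\neg,\vee,\wedge,\Rightarrow,\dots$; - for an individual variable $x$ and a formula $F$: the term $\varepsilon x.\,F$ and the formulas $\exists x.\,F$ and $\forall x.\,F$, each binding $x$. Formulas are identified modulo renaming of bound variables. Substitution $F\{x\mapsto t\}$ is capture-avoiding. For $Q\in\{\exists,\forall\}$, write $\neg^{\forall}$ for $\neg$ and $\neg^{\exists}$ for the empty string. The relation $F_1\to F_2$ holds iff $F_2$ is obtained from $F_1$ by replacing one occurrence of a subformula $Q x.\,A$ by $A\{x\mapsto \varepsilon x.\,\neg^{Q}A\}$. The occurrence may lie anywhere in $F_1$, including inside $\varepsilon$-terms and under binders. -}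

module Defs where

-- Terms and formulas of first-order logic with Hilbert's ε-binder,
-- in well-scoped de Bruijn representation (so formulas are
-- identified modulo renaming of bound variables, and substitution
-- is capture-avoiding by construction).

open import Data.Nat using (ℕ; zero; suc)
open import Data.Fin using (Fin; zero; suc)
open import Data.Vec using (Vec; []; _∷_)

-- A signature: for each arity k, the k-ary function symbols,
-- predicate symbols and (free, second-order) formula variables.
record Signature : Set₁ where
  field
    Fun  : ℕ → Set
    Pred : ℕ → Set
    FVar : ℕ → Set
open Signature public

data BinOp : Set where
  and or imp iff : BinOp

mutual
  data Term (S : Signature) (n : ℕ) : Set where
    var : Fin n → Term S n
    fun : ∀ {k} → Fun S k → Vec (Term S n) k → Term S n
    eps : Form S (suc n) → Term S n

  data Form (S : Signature) (n : ℕ) : Set where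
    pred : ∀ {k} → Pred S k → Vec (Term S n) k → Form S n
    fvar : ∀ {k} → FVar S k → Vec (Term S n) k → Form S n
    top  : Form S n
    bot  : Form S n
    neg  : Form S n → Form S n
    bin  : BinOp → Form S n → Form S n → Form S n
    ex   : Form S (suc n) → Form S n
    all  : Form S (suc n) → Form S n

module _ {S : Signature} where

  ext : ∀ {n m} → (Fin n → Fin m) → Fin (suc n) → Fin (suc m)
  ext ρ zero    = zero
  ext ρ (suc i) = suc (ρ i)

  mutual
    renT : ∀ {n m} → (Fin n → Fin m) → Term S n → Term S m
    renT ρ (var i)    = var (ρ i)
    renT ρ (fun f ts) = fun f (renTs ρ ts)
    renT ρ (eps A)    = eps (renF (ext ρ) A)

    renTs : ∀ {n m k} → (Fin n → Fin m) → Vec (Term S n) k → Vec (Term S m) k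
    renTs ρ []       = []
    renTs ρ (t ∷ ts) = renT ρ t ∷ renTs ρ ts

    renF : ∀ {n m} → (Fin n → Fin m) → Form S n → Form S m
    renF ρ (pred p ts)  = pred p (renTs ρ ts)
    renF ρ (fvar X ts)  = fvar X (renTs ρ ts)
    renF ρ top          = top
    renF ρ bot          = bot
    renF ρ (neg A)      = neg (renF ρ A)
    renF ρ (bin o A B)  = bin o (renF ρ A) (renF ρ B)
    renF ρ (ex A)       = ex (renF (ext ρ) A)
    renF ρ (all A)      = all (renF (ext ρ) A)

  exts : ∀ {n m} → (Fin n → Term S m) → Fin (suc n) → Term S (suc m)
  exts σ zero    = var zero
  exts σ (suc i) = renT suc (σ i)

  mutual
    subT : ∀ {n m} → (Fin n → Term S m) → Term S n → Term S m
    subT σ (var i)    = σ i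
    subT σ (fun f ts) = fun f (subTs σ ts)
    subT σ (eps A)    = eps (subF (exts σ) A)

    subTs : ∀ {n m k} → (Fin n → Term S m) → Vec (Term S n) k → Vec (Term S m) k
    subTs σ []       = []
    subTs σ (t ∷ ts) = subT σ t ∷ subTs σ ts

    subF : ∀ {n m} → (Fin n → Term S m) → Form S n → Form S m
    subF σ (pred p ts)  = pred p (subTs σ ts)
    subF σ (fvar X ts)  = fvar X (subTs σ ts)
    subF σ top          = top
    subF σ bot          = bot
    subF σ (neg A)      = neg (subF σ A)
    subF σ (bin o A B)  = bin o (subF σ A) (subF σ B)
    subF σ (ex A)       = ex (subF (exts σ) A)
    subF σ (all A)      = all (subF (exts σ) A)

  single : ∀ {n} → Term S n → Fin (suc n) → Term S n
  single t zero    = t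
  single t (suc i) = var i

  _[_] : ∀ {n} → Form S (suc n) → Term S n → Form S n
  A [ t ] = subF (single t) A

mutual
  data _⟶F_ {S : Signature} {n : ℕ} : Form S n → Form S n → Set where
    ex-elim  : ∀ A → ex A ⟶F (A [ eps A ])
    all-elim : ∀ A → all A ⟶F (A [ eps (neg A) ])
    pred-c   : ∀ {k} {p : Pred S k} {ts us} → ts ⟶Ts us → pred p ts ⟶F pred p us
    fvar-c   : ∀ {k} {X : FVar S k} {ts us} → ts ⟶Ts us → fvar X ts ⟶F fvar X us
    neg-c    : ∀ {A B} → A ⟶F B → neg A ⟶F neg B
    bin-l    : ∀ {o A A′ B} → A ⟶F A′ → bin o A B ⟶F bin o A′ B
    bin-r    : ∀ {o A B B′} → B ⟶F B′ → bin o A B ⟶F bin o A B′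
    ex-c     : ∀ {A B} → A ⟶F B → ex A ⟶F ex B
    all-c    : ∀ {A B} → A ⟶F B → all A ⟶F all B

  data _⟶T_ {S : Signature} {n : ℕ} : Term S n → Term S n → Set where
    fun-c : ∀ {k} {f : Fun S k} {ts us} → ts ⟶Ts us → fun f ts ⟶T fun f us
    eps-c : ∀ {A B} → A ⟶F B → eps A ⟶T eps B

  data _⟶Ts_ {S : Signature} {n : ℕ} : ∀ {k} → Vec (Term S n) k → Vec (Term S n) k → Set where
    here  : ∀ {k t u} {ts : Vec (Term S n) k} → t ⟶T u → (t ∷ ts) ⟶Ts (u ∷ ts)
    there : ∀ {k t} {ts us : Vec (Term S n) k} → ts ⟶Ts us → (t ∷ ts) ⟶Ts (t ∷ us)

-- Proof idea (Tait–Martin-Löf).  Let ⇛ be parallel reduction, which may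
-- eliminate any set of quantifiers at once, including quantifiers inside
-- the bodies of the quantifiers being eliminated.  Then ⟶ ⊆ ⇛ ⊆ ⟶*, so
-- ⟶* and ⇛* coincide.  Eliminating every quantifier of A (innermost
-- first) gives its complete development dev A, and every parallel step
-- A ⇛ B can be completed by B ⇛ dev A, because ⇛ is stable under
-- substitution.  This triangle property makes ⇛ diamond, hence ⇛* and
-- thus ⟶* confluent.
module Submission where

open import Defs
open import Data.Nat using (ℕ; suc)
open import Data.Fin using (Fin; zero; suc)
open import Data.Vec using (Vec; []; _∷_)
open import Data.Product using (∃-syntax; _×_; _,_)
open import Relation.Binary.Core using (Rel; _⇒_)
open import Relation.Binary.Construct.Closure.ReflexiveTransitive
  using (Star; ε; _◅_; _◅◅_; gmap; map; return; _⋆)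
open import Relation.Binary.Rewriting using (Confluent)
open import Relation.Binary.PropositionalEquality
  using (_≡_; refl; sym; trans; cong; cong₂; subst)

Diamond : ∀ {a ℓ} {A : Set a} → Rel A ℓ → Set _
Diamond _⇛_ = ∀ {x y z} → x ⇛ y → x ⇛ z → ∃[ w ] (y ⇛ w × z ⇛ w)

module _ {a ℓ} {A : Set a} {_⇛_ : Rel A ℓ} where

  triangle⇒diamond : (dev : A → A) → (∀ {x y} → x ⇛ y → y ⇛ dev x) → Diamond _⇛_
  triangle⇒diamond dev triangle {x} xy xz = dev x , triangle xy , triangle xz

  diamond⇒confluent : Diamond _⇛_ → Confluent _⇛_
  diamond⇒confluent diamond = confluent
    where
    strip : ∀ {x y z} → x ⇛ y → Star _⇛_ x z → ∃[ w ] (Star _⇛_ y w × z ⇛ w)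
    strip {y = y} xy ε = y , ε , xy
    strip xy (xx′ ◅ x′z) with diamond xy xx′
    ... | w₁ , yw₁ , x′w₁ with strip x′w₁ x′z
    ... | w , w₁w , zw = w , yw₁ ◅ w₁w , zw

    confluent : Confluent _⇛_
    confluent {C = z} ε xz = z , xz , ε
    confluent (xx′ ◅ x′y) xz with strip xx′ xz
    ... | w , x′w , zw with confluent x′y x′w
    ... | v , yv , wv = v , yv , zw ◅ wv

module _ {a ℓ₁ ℓ₂} {A : Set a} {_⟶_ : Rel A ℓ₁} {_⇛_ : Rel A ℓ₂} where

  confluent-between : _⟶_ ⇒ _⇛_ → _⇛_ ⇒ Star _⟶_ →
                      Confluent _⇛_ → Confluent _⟶_
  confluent-between ⟶⊆⇛ ⇛⊆⟶* confluent xy xz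
    with confluent (map ⟶⊆⇛ xy) (map ⟶⊆⇛ xz)
  ... | w , yw , zw = w , (⇛⊆⟶* ⋆) yw , (⇛⊆⟶* ⋆) zw

module _ {S : Signature} where

  ext-∘ : ∀ {n m k} {ρ₁ : Fin m → Fin k} {ρ₂ : Fin n → Fin m} {ρ₃ : Fin n → Fin k} →
          (∀ i → ρ₁ (ρ₂ i) ≡ ρ₃ i) → ∀ i → ext {S = S} ρ₁ (ext {S = S} ρ₂ i) ≡ ext {S = S} ρ₃ i
  ext-∘ h zero    = refl
  ext-∘ h (suc i) = cong suc (h i)

  mutual
    renT∘renT : ∀ {n m k} {ρ₁ : Fin m → Fin k} {ρ₂ : Fin n → Fin m} {ρ₃ : Fin n → Fin k} →
                (∀ i → ρ₁ (ρ₂ i) ≡ ρ₃ i) → (t : Term S n) → renT ρ₁ (renT ρ₂ t) ≡ renT ρ₃ t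
    renT∘renT h (var i)    = cong var (h i)
    renT∘renT h (fun f ts) = cong (fun f) (renTs∘renTs h ts)
    renT∘renT h (eps A)    = cong eps (renF∘renF (ext-∘ h) A)

    renTs∘renTs : ∀ {n m k j} {ρ₁ : Fin m → Fin k} {ρ₂ : Fin n → Fin m} {ρ₃ : Fin n → Fin k} →
                  (∀ i → ρ₁ (ρ₂ i) ≡ ρ₃ i) → (ts : Vec (Term S n) j) →
                  renTs ρ₁ (renTs ρ₂ ts) ≡ renTs ρ₃ ts
    renTs∘renTs h []       = refl
    renTs∘renTs h (t ∷ ts) = cong₂ _∷_ (renT∘renT h t) (renTs∘renTs h ts)

    renF∘renF : ∀ {n m k} {ρ₁ : Fin m → Fin k} {ρ₂ : Fin n → Fin m} {ρ₃ : Fin n → Fin k} →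
                (∀ i → ρ₁ (ρ₂ i) ≡ ρ₃ i) → (A : Form S n) → renF ρ₁ (renF ρ₂ A) ≡ renF ρ₃ A
    renF∘renF h (pred p ts) = cong (pred p) (renTs∘renTs h ts)
    renF∘renF h (fvar X ts) = cong (fvar X) (renTs∘renTs h ts)
    renF∘renF h top         = refl
    renF∘renF h bot         = refl
    renF∘renF h (neg A)     = cong neg (renF∘renF h A)
    renF∘renF h (bin o A B) = cong₂ (bin o) (renF∘renF h A) (renF∘renF h B)
    renF∘renF h (ex A)      = cong ex (renF∘renF (ext-∘ h) A)
    renF∘renF h (all A)     = cong all (renF∘renF (ext-∘ h) A)

  exts∘ext : ∀ {n m k} {σ : Fin m → Term S k} {ρ : Fin n → Fin m} {τ : Fin n → Term S k} →
             (∀ i → σ (ρ i) ≡ τ i) → ∀ i → exts σ (ext {S = S} ρ i) ≡ exts τ i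
  exts∘ext h zero    = refl
  exts∘ext h (suc i) = cong (renT suc) (h i)

  mutual
    subT∘renT : ∀ {n m k} {σ : Fin m → Term S k} {ρ : Fin n → Fin m} {τ : Fin n → Term S k} →
                (∀ i → σ (ρ i) ≡ τ i) → (t : Term S n) → subT σ (renT ρ t) ≡ subT τ t
    subT∘renT h (var i)    = h i
    subT∘renT h (fun f ts) = cong (fun f) (subTs∘renTs h ts)
    subT∘renT h (eps A)    = cong eps (subF∘renF (exts∘ext h) A)

    subTs∘renTs : ∀ {n m k j} {σ : Fin m → Term S k} {ρ : Fin n → Fin m} {τ : Fin n → Term S k} →
                  (∀ i → σ (ρ i) ≡ τ i) → (ts : Vec (Term S n) j) →
                  subTs σ (renTs ρ ts) ≡ subTs τ ts
    subTs∘renTs h []       = refl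
    subTs∘renTs h (t ∷ ts) = cong₂ _∷_ (subT∘renT h t) (subTs∘renTs h ts)

    subF∘renF : ∀ {n m k} {σ : Fin m → Term S k} {ρ : Fin n → Fin m} {τ : Fin n → Term S k} →
                (∀ i → σ (ρ i) ≡ τ i) → (A : Form S n) → subF σ (renF ρ A) ≡ subF τ A
    subF∘renF h (pred p ts) = cong (pred p) (subTs∘renTs h ts)
    subF∘renF h (fvar X ts) = cong (fvar X) (subTs∘renTs h ts)
    subF∘renF h top         = refl
    subF∘renF h bot         = refl
    subF∘renF h (neg A)     = cong neg (subF∘renF h A)
    subF∘renF h (bin o A B) = cong₂ (bin o) (subF∘renF h A) (subF∘renF h B)
    subF∘renF h (ex A)      = cong ex (subF∘renF (exts∘ext h) A)
    subF∘renF h (all A)     = cong all (subF∘renF (exts∘ext h) A)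

  renT-weaken-commute : ∀ {n m} (ρ : Fin n → Fin m) (t : Term S n) →
                        renT (ext {S = S} ρ) (renT suc t) ≡ renT suc (renT ρ t)
  renT-weaken-commute ρ t = trans (renT∘renT (λ _ → refl) t) (sym (renT∘renT (λ _ → refl) t))

  ext∘exts : ∀ {n m k} {ρ : Fin m → Fin k} {σ : Fin n → Term S m} {τ : Fin n → Term S k} →
             (∀ i → renT ρ (σ i) ≡ τ i) → ∀ i → renT (ext {S = S} ρ) (exts σ i) ≡ exts τ i
  ext∘exts h zero                = refl
  ext∘exts {ρ = ρ} {σ} h (suc i) = trans (renT-weaken-commute ρ (σ i)) (cong (renT suc) (h i))

  mutual
    renT∘subT : ∀ {n m k} {ρ : Fin m → Fin k} {σ : Fin n → Term S m} {τ : Fin n → Term S k} →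
                (∀ i → renT ρ (σ i) ≡ τ i) → (t : Term S n) → renT ρ (subT σ t) ≡ subT τ t
    renT∘subT h (var i)    = h i
    renT∘subT h (fun f ts) = cong (fun f) (renTs∘subTs h ts)
    renT∘subT h (eps A)    = cong eps (renF∘subF (ext∘exts h) A)

    renTs∘subTs : ∀ {n m k j} {ρ : Fin m → Fin k} {σ : Fin n → Term S m} {τ : Fin n → Term S k} →
                  (∀ i → renT ρ (σ i) ≡ τ i) → (ts : Vec (Term S n) j) →
                  renTs ρ (subTs σ ts) ≡ subTs τ ts
    renTs∘subTs h []       = refl
    renTs∘subTs h (t ∷ ts) = cong₂ _∷_ (renT∘subT h t) (renTs∘subTs h ts)

    renF∘subF : ∀ {n m k} {ρ : Fin m → Fin k} {σ : Fin n → Term S m} {τ : Fin n → Term S k} →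
                (∀ i → renT ρ (σ i) ≡ τ i) → (A : Form S n) → renF ρ (subF σ A) ≡ subF τ A
    renF∘subF h (pred p ts) = cong (pred p) (renTs∘subTs h ts)
    renF∘subF h (fvar X ts) = cong (fvar X) (renTs∘subTs h ts)
    renF∘subF h top         = refl
    renF∘subF h bot         = refl
    renF∘subF h (neg A)     = cong neg (renF∘subF h A)
    renF∘subF h (bin o A B) = cong₂ (bin o) (renF∘subF h A) (renF∘subF h B)
    renF∘subF h (ex A)      = cong ex (renF∘subF (ext∘exts h) A)
    renF∘subF h (all A)     = cong all (renF∘subF (ext∘exts h) A)

  subT-weaken-commute : ∀ {n m} (σ : Fin n → Term S m) (t : Term S n) →
                        subT (exts σ) (renT suc t) ≡ renT suc (subT σ t)
  subT-weaken-commute σ t = trans (subT∘renT (λ _ → refl) t) (sym (renT∘subT (λ _ → refl) t))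

  exts∘exts : ∀ {n m k} {σ : Fin m → Term S k} {τ : Fin n → Term S m} {υ : Fin n → Term S k} →
              (∀ i → subT σ (τ i) ≡ υ i) → ∀ i → subT (exts σ) (exts τ i) ≡ exts υ i
  exts∘exts h zero                = refl
  exts∘exts {σ = σ} {τ} h (suc i) = trans (subT-weaken-commute σ (τ i)) (cong (renT suc) (h i))

  mutual
    subT∘subT : ∀ {n m k} {σ : Fin m → Term S k} {τ : Fin n → Term S m} {υ : Fin n → Term S k} →
                (∀ i → subT σ (τ i) ≡ υ i) → (t : Term S n) → subT σ (subT τ t) ≡ subT υ t
    subT∘subT h (var i)    = h i
    subT∘subT h (fun f ts) = cong (fun f) (subTs∘subTs h ts)
    subT∘subT h (eps A)    = cong eps (subF∘subF (exts∘exts h) A)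

    subTs∘subTs : ∀ {n m k j} {σ : Fin m → Term S k} {τ : Fin n → Term S m} {υ : Fin n → Term S k} →
                  (∀ i → subT σ (τ i) ≡ υ i) → (ts : Vec (Term S n) j) →
                  subTs σ (subTs τ ts) ≡ subTs υ ts
    subTs∘subTs h []       = refl
    subTs∘subTs h (t ∷ ts) = cong₂ _∷_ (subT∘subT h t) (subTs∘subTs h ts)

    subF∘subF : ∀ {n m k} {σ : Fin m → Term S k} {τ : Fin n → Term S m} {υ : Fin n → Term S k} →
                (∀ i → subT σ (τ i) ≡ υ i) → (A : Form S n) → subF σ (subF τ A) ≡ subF υ A
    subF∘subF h (pred p ts) = cong (pred p) (subTs∘subTs h ts)
    subF∘subF h (fvar X ts) = cong (fvar X) (subTs∘subTs h ts)
    subF∘subF h top         = refl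
    subF∘subF h bot         = refl
    subF∘subF h (neg A)     = cong neg (subF∘subF h A)
    subF∘subF h (bin o A B) = cong₂ (bin o) (subF∘subF h A) (subF∘subF h B)
    subF∘subF h (ex A)      = cong ex (subF∘subF (exts∘exts h) A)
    subF∘subF h (all A)     = cong all (subF∘subF (exts∘exts h) A)

  exts-var : ∀ {n} {σ : Fin n → Term S n} → (∀ i → σ i ≡ var i) → ∀ i → exts σ i ≡ var i
  exts-var h zero    = refl
  exts-var h (suc i) = cong (renT suc) (h i)

  mutual
    subT-id : ∀ {n} {σ : Fin n → Term S n} → (∀ i → σ i ≡ var i) → (t : Term S n) → subT σ t ≡ t
    subT-id h (var i)    = h i
    subT-id h (fun f ts) = cong (fun f) (subTs-id h ts)
    subT-id h (eps A)    = cong eps (subF-id (exts-var h) A)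

    subTs-id : ∀ {n j} {σ : Fin n → Term S n} → (∀ i → σ i ≡ var i) →
               (ts : Vec (Term S n) j) → subTs σ ts ≡ ts
    subTs-id h []       = refl
    subTs-id h (t ∷ ts) = cong₂ _∷_ (subT-id h t) (subTs-id h ts)

    subF-id : ∀ {n} {σ : Fin n → Term S n} → (∀ i → σ i ≡ var i) → (A : Form S n) → subF σ A ≡ A
    subF-id h (pred p ts) = cong (pred p) (subTs-id h ts)
    subF-id h (fvar X ts) = cong (fvar X) (subTs-id h ts)
    subF-id h top         = refl
    subF-id h bot         = refl
    subF-id h (neg A)     = cong neg (subF-id h A)
    subF-id h (bin o A B) = cong₂ (bin o) (subF-id h A) (subF-id h B)
    subF-id h (ex A)      = cong ex (subF-id (exts-var h) A)
    subF-id h (all A)     = cong all (subF-id (exts-var h) A)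

  renF-[] : ∀ {n m} (ρ : Fin n → Fin m) (B : Form S (suc n)) (t : Term S n) →
            renF ρ (B [ t ]) ≡ renF (ext {S = S} ρ) B [ renT ρ t ]
  renF-[] ρ B t = trans (renF∘subF ren-single B) (sym (subF∘renF (λ _ → refl) B))
    where
    ren-single : ∀ i → renT ρ (single t i) ≡ single (renT ρ t) (ext {S = S} ρ i)
    ren-single zero    = refl
    ren-single (suc i) = refl

  subF-[] : ∀ {n m} (σ : Fin n → Term S m) (B : Form S (suc n)) (t : Term S n) →
            subF σ (B [ t ]) ≡ subF (exts σ) B [ subT σ t ]
  subF-[] σ B t = trans (subF∘subF (λ _ → refl) B) (sym (subF∘subF single-exts B))
    where
    single-exts : ∀ i → subT (single (subT σ t)) (exts σ i) ≡ subT σ (single t i)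
    single-exts zero    = refl
    single-exts (suc i) = trans (subT∘renT {τ = var} (λ _ → refl) (σ i)) (subT-id (λ _ → refl) (σ i))

  infix 4 _⇛F_ _⇛T_ _⇛Ts_

  mutual
    data _⇛F_ {n : ℕ} : Form S n → Form S n → Set where
      pred-p : ∀ {k} {p : Pred S k} {ts us} → ts ⇛Ts us → pred p ts ⇛F pred p us
      fvar-p : ∀ {k} {X : FVar S k} {ts us} → ts ⇛Ts us → fvar X ts ⇛F fvar X us
      top-p  : top ⇛F top
      bot-p  : bot ⇛F bot
      neg-p  : ∀ {A B} → A ⇛F B → neg A ⇛F neg B
      bin-p  : ∀ {o A A′ B B′} → A ⇛F A′ → B ⇛F B′ → bin o A B ⇛F bin o A′ B′
      ex-p   : ∀ {A B} → A ⇛F B → ex A ⇛F ex B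
      all-p  : ∀ {A B} → A ⇛F B → all A ⇛F all B
      ex-β   : ∀ {A B} → A ⇛F B → ex A ⇛F B [ eps B ]
      all-β  : ∀ {A B} → A ⇛F B → all A ⇛F B [ eps (neg B) ]

    data _⇛T_ {n : ℕ} : Term S n → Term S n → Set where
      var-p : ∀ {i} → var i ⇛T var i
      fun-p : ∀ {k} {f : Fun S k} {ts us} → ts ⇛Ts us → fun f ts ⇛T fun f us
      eps-p : ∀ {A B} → A ⇛F B → eps A ⇛T eps B

    data _⇛Ts_ {n : ℕ} : ∀ {k} → Vec (Term S n) k → Vec (Term S n) k → Set where
      []-p : [] ⇛Ts []
      ∷-p  : ∀ {k t u} {ts us : Vec (Term S n) k} → t ⇛T u → ts ⇛Ts us → t ∷ ts ⇛Ts u ∷ us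

  mutual
    ⇛F-refl : ∀ {n} (A : Form S n) → A ⇛F A
    ⇛F-refl (pred p ts) = pred-p (⇛Ts-refl ts)
    ⇛F-refl (fvar X ts) = fvar-p (⇛Ts-refl ts)
    ⇛F-refl top         = top-p
    ⇛F-refl bot         = bot-p
    ⇛F-refl (neg A)     = neg-p (⇛F-refl A)
    ⇛F-refl (bin o A B) = bin-p (⇛F-refl A) (⇛F-refl B)
    ⇛F-refl (ex A)      = ex-p (⇛F-refl A)
    ⇛F-refl (all A)     = all-p (⇛F-refl A)

    ⇛T-refl : ∀ {n} (t : Term S n) → t ⇛T t
    ⇛T-refl (var i)    = var-p
    ⇛T-refl (fun f ts) = fun-p (⇛Ts-refl ts)
    ⇛T-refl (eps A)    = eps-p (⇛F-refl A)

    ⇛Ts-refl : ∀ {n k} (ts : Vec (Term S n) k) → ts ⇛Ts ts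
    ⇛Ts-refl []       = []-p
    ⇛Ts-refl (t ∷ ts) = ∷-p (⇛T-refl t) (⇛Ts-refl ts)

  mutual
    ⇛F-renF : ∀ {n m} (ρ : Fin n → Fin m) {A B : Form S n} → A ⇛F B → renF ρ A ⇛F renF ρ B
    ⇛F-renF ρ (pred-p r)  = pred-p (⇛Ts-renTs ρ r)
    ⇛F-renF ρ (fvar-p r)  = fvar-p (⇛Ts-renTs ρ r)
    ⇛F-renF ρ top-p       = top-p
    ⇛F-renF ρ bot-p       = bot-p
    ⇛F-renF ρ (neg-p r)   = neg-p (⇛F-renF ρ r)
    ⇛F-renF ρ (bin-p r q) = bin-p (⇛F-renF ρ r) (⇛F-renF ρ q)
    ⇛F-renF ρ (ex-p r)    = ex-p (⇛F-renF (ext {S = S} ρ) r)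
    ⇛F-renF ρ (all-p r)   = all-p (⇛F-renF (ext {S = S} ρ) r)
    ⇛F-renF ρ (ex-β {B = B} r) =
      subst (_ ⇛F_) (sym (renF-[] ρ B (eps B))) (ex-β (⇛F-renF (ext {S = S} ρ) r))
    ⇛F-renF ρ (all-β {B = B} r) =
      subst (_ ⇛F_) (sym (renF-[] ρ B (eps (neg B)))) (all-β (⇛F-renF (ext {S = S} ρ) r))

    ⇛T-renT : ∀ {n m} (ρ : Fin n → Fin m) {t u : Term S n} → t ⇛T u → renT ρ t ⇛T renT ρ u
    ⇛T-renT ρ var-p     = var-p
    ⇛T-renT ρ (fun-p r) = fun-p (⇛Ts-renTs ρ r)
    ⇛T-renT ρ (eps-p r) = eps-p (⇛F-renF (ext {S = S} ρ) r)

    ⇛Ts-renTs : ∀ {n m k} (ρ : Fin n → Fin m) {ts us : Vec (Term S n) k} →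
                ts ⇛Ts us → renTs ρ ts ⇛Ts renTs ρ us
    ⇛Ts-renTs ρ []-p      = []-p
    ⇛Ts-renTs ρ (∷-p r q) = ∷-p (⇛T-renT ρ r) (⇛Ts-renTs ρ q)

  ⇛-exts : ∀ {n m} {σ τ : Fin n → Term S m} → (∀ i → σ i ⇛T τ i) → ∀ i → exts σ i ⇛T exts τ i
  ⇛-exts h zero    = var-p
  ⇛-exts h (suc i) = ⇛T-renT suc (h i)

  mutual
    ⇛F-subF : ∀ {n m} {σ τ : Fin n → Term S m} → (∀ i → σ i ⇛T τ i) →
              {A B : Form S n} → A ⇛F B → subF σ A ⇛F subF τ B
    ⇛F-subF h (pred-p r)  = pred-p (⇛Ts-subTs h r)
    ⇛F-subF h (fvar-p r)  = fvar-p (⇛Ts-subTs h r)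
    ⇛F-subF h top-p       = top-p
    ⇛F-subF h bot-p       = bot-p
    ⇛F-subF h (neg-p r)   = neg-p (⇛F-subF h r)
    ⇛F-subF h (bin-p r q) = bin-p (⇛F-subF h r) (⇛F-subF h q)
    ⇛F-subF h (ex-p r)    = ex-p (⇛F-subF (⇛-exts h) r)
    ⇛F-subF h (all-p r)   = all-p (⇛F-subF (⇛-exts h) r)
    ⇛F-subF {τ = τ} h (ex-β {B = B} r) =
      subst (_ ⇛F_) (sym (subF-[] τ B (eps B))) (ex-β (⇛F-subF (⇛-exts h) r))
    ⇛F-subF {τ = τ} h (all-β {B = B} r) =
      subst (_ ⇛F_) (sym (subF-[] τ B (eps (neg B)))) (all-β (⇛F-subF (⇛-exts h) r))

    ⇛T-subT : ∀ {n m} {σ τ : Fin n → Term S m} → (∀ i → σ i ⇛T τ i) →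
              {t u : Term S n} → t ⇛T u → subT σ t ⇛T subT τ u
    ⇛T-subT h (var-p {i}) = h i
    ⇛T-subT h (fun-p r)   = fun-p (⇛Ts-subTs h r)
    ⇛T-subT h (eps-p r)   = eps-p (⇛F-subF (⇛-exts h) r)

    ⇛Ts-subTs : ∀ {n m k} {σ τ : Fin n → Term S m} → (∀ i → σ i ⇛T τ i) →
                {ts us : Vec (Term S n) k} → ts ⇛Ts us → subTs σ ts ⇛Ts subTs τ us
    ⇛Ts-subTs h []-p      = []-p
    ⇛Ts-subTs h (∷-p r q) = ∷-p (⇛T-subT h r) (⇛Ts-subTs h q)

  ⇛F-[] : ∀ {n} {B C : Form S (suc n)} {u v : Term S n} → B ⇛F C → u ⇛T v → B [ u ] ⇛F C [ v ]
  ⇛F-[] {u = u} {v} B⇛C u⇛v = ⇛F-subF single-⇛ B⇛C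
    where
    single-⇛ : ∀ i → single u i ⇛T single v i
    single-⇛ zero    = u⇛v
    single-⇛ (suc i) = var-p

  mutual
    devF : ∀ {n} → Form S n → Form S n
    devF (pred p ts) = pred p (devTs ts)
    devF (fvar X ts) = fvar X (devTs ts)
    devF top         = top
    devF bot         = bot
    devF (neg A)     = neg (devF A)
    devF (bin o A B) = bin o (devF A) (devF B)
    devF (ex A)      = devF A [ eps (devF A) ]
    devF (all A)     = devF A [ eps (neg (devF A)) ]

    devT : ∀ {n} → Term S n → Term S n
    devT (var i)    = var i
    devT (fun f ts) = fun f (devTs ts)
    devT (eps A)    = eps (devF A)

    devTs : ∀ {n k} → Vec (Term S n) k → Vec (Term S n) k
    devTs []       = []
    devTs (t ∷ ts) = devT t ∷ devTs ts

  mutual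
    ⇛F-devF : ∀ {n} {A B : Form S n} → A ⇛F B → B ⇛F devF A
    ⇛F-devF (pred-p r)  = pred-p (⇛Ts-devTs r)
    ⇛F-devF (fvar-p r)  = fvar-p (⇛Ts-devTs r)
    ⇛F-devF top-p       = top-p
    ⇛F-devF bot-p       = bot-p
    ⇛F-devF (neg-p r)   = neg-p (⇛F-devF r)
    ⇛F-devF (bin-p r q) = bin-p (⇛F-devF r) (⇛F-devF q)
    ⇛F-devF (ex-p r)    = ex-β (⇛F-devF r)
    ⇛F-devF (all-p r)   = all-β (⇛F-devF r)
    ⇛F-devF (ex-β r)    = ⇛F-[] (⇛F-devF r) (eps-p (⇛F-devF r))
    ⇛F-devF (all-β r)   = ⇛F-[] (⇛F-devF r) (eps-p (neg-p (⇛F-devF r)))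

    ⇛T-devT : ∀ {n} {t u : Term S n} → t ⇛T u → u ⇛T devT t
    ⇛T-devT var-p     = var-p
    ⇛T-devT (fun-p r) = fun-p (⇛Ts-devTs r)
    ⇛T-devT (eps-p r) = eps-p (⇛F-devF r)

    ⇛Ts-devTs : ∀ {n k} {ts us : Vec (Term S n) k} → ts ⇛Ts us → us ⇛Ts devTs ts
    ⇛Ts-devTs []-p      = []-p
    ⇛Ts-devTs (∷-p r q) = ∷-p (⇛T-devT r) (⇛Ts-devTs q)

  ⇛F-confluent : ∀ {n} → Confluent (_⇛F_ {n})
  ⇛F-confluent = diamond⇒confluent (triangle⇒diamond {_⇛_ = _⇛F_} devF ⇛F-devF)

  mutual
    ⟶F⇒⇛F : ∀ {n} {A B : Form S n} → A ⟶F B → A ⇛F B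
    ⟶F⇒⇛F (ex-elim A)       = ex-β (⇛F-refl A)
    ⟶F⇒⇛F (all-elim A)      = all-β (⇛F-refl A)
    ⟶F⇒⇛F (pred-c s)        = pred-p (⟶Ts⇒⇛Ts s)
    ⟶F⇒⇛F (fvar-c s)        = fvar-p (⟶Ts⇒⇛Ts s)
    ⟶F⇒⇛F (neg-c s)         = neg-p (⟶F⇒⇛F s)
    ⟶F⇒⇛F (bin-l {B = B} s) = bin-p (⟶F⇒⇛F s) (⇛F-refl B)
    ⟶F⇒⇛F (bin-r {A = A} s) = bin-p (⇛F-refl A) (⟶F⇒⇛F s)
    ⟶F⇒⇛F (ex-c s)          = ex-p (⟶F⇒⇛F s)
    ⟶F⇒⇛F (all-c s)         = all-p (⟶F⇒⇛F s)

    ⟶T⇒⇛T : ∀ {n} {t u : Term S n} → t ⟶T u → t ⇛T u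
    ⟶T⇒⇛T (fun-c s) = fun-p (⟶Ts⇒⇛Ts s)
    ⟶T⇒⇛T (eps-c s) = eps-p (⟶F⇒⇛F s)

    ⟶Ts⇒⇛Ts : ∀ {n k} {ts us : Vec (Term S n) k} → ts ⟶Ts us → ts ⇛Ts us
    ⟶Ts⇒⇛Ts (here {ts = ts} s) = ∷-p (⟶T⇒⇛T s) (⇛Ts-refl ts)
    ⟶Ts⇒⇛Ts (there {t = t} s)  = ∷-p (⇛T-refl t) (⟶Ts⇒⇛Ts s)

  mutual
    ⇛F⇒⟶F* : ∀ {n} {A B : Form S n} → A ⇛F B → Star _⟶F_ A B
    ⇛F⇒⟶F* (pred-p r)  = gmap (pred _) pred-c (⇛Ts⇒⟶Ts* r)
    ⇛F⇒⟶F* (fvar-p r)  = gmap (fvar _) fvar-c (⇛Ts⇒⟶Ts* r)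
    ⇛F⇒⟶F* top-p       = ε
    ⇛F⇒⟶F* bot-p       = ε
    ⇛F⇒⟶F* (neg-p r)   = gmap neg neg-c (⇛F⇒⟶F* r)
    ⇛F⇒⟶F* (bin-p {o} {A′ = A′} {B = B} r q) =
      gmap (λ C → bin o C B) bin-l (⇛F⇒⟶F* r) ◅◅ gmap (bin o A′) bin-r (⇛F⇒⟶F* q)
    ⇛F⇒⟶F* (ex-p r)    = gmap ex ex-c (⇛F⇒⟶F* r)
    ⇛F⇒⟶F* (all-p r)   = gmap all all-c (⇛F⇒⟶F* r)
    ⇛F⇒⟶F* (ex-β {B = B} r)  = gmap ex ex-c (⇛F⇒⟶F* r) ◅◅ return (ex-elim B)
    ⇛F⇒⟶F* (all-β {B = B} r) = gmap all all-c (⇛F⇒⟶F* r) ◅◅ return (all-elim B)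

    ⇛T⇒⟶T* : ∀ {n} {t u : Term S n} → t ⇛T u → Star _⟶T_ t u
    ⇛T⇒⟶T* var-p     = ε
    ⇛T⇒⟶T* (fun-p r) = gmap (fun _) fun-c (⇛Ts⇒⟶Ts* r)
    ⇛T⇒⟶T* (eps-p r) = gmap eps eps-c (⇛F⇒⟶F* r)

    ⇛Ts⇒⟶Ts* : ∀ {n k} {ts us : Vec (Term S n) k} → ts ⇛Ts us → Star _⟶Ts_ ts us
    ⇛Ts⇒⟶Ts* []-p = ε
    ⇛Ts⇒⟶Ts* (∷-p {u = u} {ts = ts} r q) =
      gmap (_∷ ts) here (⇛T⇒⟶T* r) ◅◅ gmap (u ∷_) there (⇛Ts⇒⟶Ts* q)

theorem3p8 : (S : Signature) (n : ℕ) (F F₁ F₂ : Form S n) →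
    Star _⟶F_ F F₁ → Star _⟶F_ F F₂ →
    ∃[ G ] (Star _⟶F_ F₁ G × Star _⟶F_ F₂ G)
theorem3p8 S n F F₁ F₂ = confluent-between ⟶F⇒⇛F ⇛F⇒⟶F* ⇛F-confluent
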